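{- Let $N$ be a net. Every finite path of $N$ can be extended to a complete path of $N$ such that all transitions in the extension have labels in $O\cup\{\tau\}$.
   Context: Actions $Act=H\uplus O\uplus\{\tau\}$; actions in $O\cup\{\tau\}$ are non-blocking. Multisets over $X$ are functions $X\to\mathbb N$ with pointwise $\le$, $+$, $-$, $\cap$. A labelled Petri net is $N=(S,T,F,M_0,\ell)$ with places $S$, transitions $T$ (disjoint), $F:(S\times T)\cup(T\times S)\to\mathbb N$, initial marking $M_0$, labelling $\ell:T\to Act$. ${}^\bullet u(s)=F(s,u)$, $u^\bullet(s)=F(u,s)$; $M[u\rangle$ iff ${}^\bullet u\le M$, giving $M[u\rangle M'$ with $M'=M-{}^\bullet u+u^\bullet$. A path is $M_0u_1M_1u_2\dots$ starting at the initial marking, infinite or ending in a marking, with $M_k[u_{k+1}\rangle M_{k+1}$; markings on paths are reachable. A net means a structural conflict net (${}^\bullet u+{}^\bullet v\le M$ implies ${}^\bullet u\cap{}^\bullet v=\emptyset$ for reachable $M$) with ${}^\bullet u\neq\emptyset$ for all $u$ and all reachable markings finite. On a path $M_0u_1M_1\dots$, a transition $v$ is continuously enabled from position $k$ onwards if $M_k[v\rangle$ and ${}^\bullet v\cap{}^\bullet u_i=\emptyset$ for all $i>k$, and then the path is $\ell(v)$-enabled. A path is complete if it is $o$-enabled for no $o\in O\cup\{\tau\}$. -}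

module Defs where

open import Data.Nat using (ℕ; zero; suc; _+_; _∸_; _⊓_; _≤_; _<_)
open import Data.Product using (Σ; ∃; _×_; _,_)
open import Data.Unit using (⊤)
open import Data.Empty using (⊥)
open import Data.List using (List)
open import Data.List.Membership.Propositional using (_∈_)
open import Relation.Nullary using (¬_)
open import Relation.Binary.PropositionalEquality using (_≡_; _≢_)

data Act (H O : Set) : Set where
  hAct : H → Act H O
  oAct : O → Act H O
  τ    : Act H O

data NonBlocking {H O : Set} : Act H O → Set where
  nb-o : (o : O) → NonBlocking (oAct o)
  nb-τ : NonBlocking τ

MSet : Set → Set
MSet X = X → ℕ

_≤ₘ_ : {X : Set} → MSet X → MSet X → Set
A ≤ₘ B = ∀ x → A x ≤ B x

_+ₘ_ : {X : Set} → MSet X → MSet X → MSet X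
(A +ₘ B) x = A x + B x

_-ₘ_ : {X : Set} → MSet X → MSet X → MSet X
(A -ₘ B) x = A x ∸ B x

_∩ₘ_ : {X : Set} → MSet X → MSet X → MSet X
(A ∩ₘ B) x = A x ⊓ B x

∅ₘ : {X : Set} → MSet X
∅ₘ x = 0

_≗ₘ_ : {X : Set} → MSet X → MSet X → Set
A ≗ₘ B = ∀ x → A x ≡ B x

FiniteMSet : {X : Set} → MSet X → Set
FiniteMSet {X} A = Σ (List X) λ xs → ∀ x → A x ≢ 0 → x ∈ xs

-- Labelled Petri nets N = (S, T, F, M₀, ℓ).  S and T are separate types
-- (hence disjoint); F is split into its two parts S×T → ℕ and T×S → ℕ.

record PetriNet (H O : Set) : Set₁ where
  field
    S   : Set
    T   : Set
    Fst : S → T → ℕ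
    Fts : T → S → ℕ
    M₀  : MSet S
    ℓ   : T → Act H O

  Marking : Set
  Marking = MSet S

  pre : T → MSet S
  pre u s = Fst s u

  post : T → MSet S
  post u s = Fts u s

  Enabled : Marking → T → Set
  Enabled M u = pre u ≤ₘ M

  Step : Marking → T → Marking → Set
  Step M u M' = Enabled M u × (M' ≗ₘ ((M -ₘ pre u) +ₘ post u))

  data Reachable : Marking → Set where
    reach-init : ∀ {M} → M ≗ₘ M₀ → Reachable M
    reach-step : ∀ {M u M'} → Reachable M → Step M u M' → Reachable M'

  data Len : Set where
    fin : ℕ → Len
    inf : Len

  -- k <ᴸ L : transition u_{k+1} exists
  _<ᴸ_ : ℕ → Len → Set
  k <ᴸ fin n = k < n
  k <ᴸ inf   = ⊤

  -- k ≤ᴸ L : marking M_k exists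
  _≤ᴸ_ : ℕ → Len → Set
  k ≤ᴸ fin n = k ≤ n
  k ≤ᴸ inf   = ⊤

  record Path : Set where
    field
      len   : Len
      mark  : ℕ → Marking                    -- mark k = M_k (meaningful for k ≤ᴸ len)
      trans : (k : ℕ) → k <ᴸ len → T         -- trans k _ = u_{k+1}
      init  : mark 0 ≗ₘ M₀
      steps : (k : ℕ) (p : k <ᴸ len) → Step (mark k) (trans k p) (mark (suc k))

  open Path public

  ContEnabled : Path → T → ℕ → Set
  ContEnabled π v k =
    (k ≤ᴸ len π) × Enabled (mark π k) v ×
    (∀ j → k ≤ j → (p : j <ᴸ len π) → (pre v ∩ₘ pre (trans π j p)) ≗ₘ ∅ₘ)

  ActEnabled : Path → Act H O → Set
  ActEnabled π a = Σ T λ v → Σ ℕ λ k → ContEnabled π v k × ℓ v ≡ a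

  Complete : Path → Set
  Complete π = ∀ a → NonBlocking a → ¬ ActEnabled π a

  Extends : (n : ℕ) → Path → Path → Set
  Extends n π π' =
    (len π ≡ fin n) × (n ≤ᴸ len π') ×
    (∀ k → k ≤ n → mark π' k ≗ₘ mark π k) ×
    (∀ k (p : k <ᴸ len π) (p' : k <ᴸ len π') → trans π' k p' ≡ trans π k p)

  NonBlockingFrom : ℕ → Path → Set
  NonBlockingFrom n π' =
    ∀ k → n ≤ k → (p : k <ᴸ len π') → NonBlocking (ℓ (trans π' k p))

  -- "N is a net": structural conflict net, nonempty presets,
  -- all reachable markings finite.

  StructuralConflict : Set
  StructuralConflict =
    ∀ M → Reachable M → ∀ u v → (pre u +ₘ pre v) ≤ₘ M → (pre u ∩ₘ pre v) ≗ₘ ∅ₘ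

  NonEmptyPresets : Set
  NonEmptyPresets = ∀ u → ¬ (pre u ≗ₘ ∅ₘ)

  FiniteReachable : Set
  FiniteReachable = ∀ M → Reachable M → FiniteMSet M

  IsNet : Set
  IsNet = StructuralConflict × NonEmptyPresets × FiniteReachable

module Submission where

-- The extension is produced by a fair scheduler started at Mₙ.  Its state
-- is a reachable marking together with a list of places covering the
-- support of the marking; the list only ever grows by appending, so a
-- place keeps its index forever.  At time j the scheduler fires some
-- enabled non-blocking transition, preferring one that consumes from the
-- place listed at index  schedule j , where  schedule  takes every value at
-- arbitrarily late times.  It stops when nothing non-blocking is enabled.
--
-- If the scheduler stops, the resulting finite path is complete because a
-- continuously enabled transition is still enabled at the last marking.
-- If it never stops, suppose a non-blocking v is continuously enabled from
-- position k.  Then v consumes from some place s (presets are nonempty),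
-- s is marked, hence listed, and at a later time where s is targeted the
-- fired transition consumes from s too, contradicting that its preset is
-- disjoint from that of v.

open import Defs
open import Level using (0ℓ)
open import Axiom.ExcludedMiddle using (ExcludedMiddle)
open import Data.Nat using (ℕ; zero; suc; _+_; _∸_; _⊓_; _≤_; _<_; _≤′_; ≤′-reflexive; ≤′-step; z≤n; _<?_; _≟_)
open import Data.Nat.Properties
open import Data.Product using (Σ; _×_; _,_; proj₁; proj₂)
open import Data.Sum using (_⊎_; inj₁; inj₂; [_,_]′)
open import Data.Unit using (tt)
open import Data.Empty using (⊥; ⊥-elim)
open import Data.Maybe using (Maybe; just; nothing)
open import Data.List using (List; []; _∷_; _++_)
open import Data.List.Relation.Unary.Any using (here; there)
open import Data.List.Membership.Propositional using (_∈_)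
open import Data.List.Membership.Propositional.Properties using (∈-++⁺ʳ)
open import Relation.Nullary using (¬_; Dec; yes; no)
open import Relation.Nullary.Decidable using (decidable-stable)
open import Relation.Unary using (Decidable)
open import Relation.Binary.PropositionalEquality
  using (_≡_; _≢_; refl; sym; cong; subst; subst₂)
  renaming (trans to ≡-trans)

m⊓n≡0⇒m≡0∨n≡0 : ∀ m n → m ⊓ n ≡ 0 → m ≡ 0 ⊎ n ≡ 0
m⊓n≡0⇒m≡0∨n≡0 zero    n       _  = inj₁ refl
m⊓n≡0⇒m≡0∨n≡0 (suc m) zero    _  = inj₂ refl
m⊓n≡0⇒m≡0∨n≡0 (suc m) (suc n) ()

Least : (ℕ → Set) → Set
Least P = Σ ℕ λ m → P m × (∀ i → i < m → ¬ P i)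

least-or-none : {P : ℕ → Set} → Decidable P → ∀ b → Least P ⊎ (∀ i → i < b → ¬ P i)
least-or-none P? zero = inj₂ λ i ()
least-or-none {P} P? (suc b) with least-or-none P? b
... | inj₁ found = inj₁ found
... | inj₂ none with P? b
...   | yes pb = inj₁ (b , pb , none)
...   | no ¬pb = inj₂ below
  where
  below : ∀ i → i < suc b → ¬ P i
  below i i<1+b with m<1+n⇒m<n∨m≡n i<1+b
  ... | inj₁ i<b  = none i i<b
  ... | inj₂ refl = ¬pb

least : {P : ℕ → Set} → Decidable P → ∀ {j} → P j → Least P
least P? {j} pj with least-or-none P? (suc j)
... | inj₁ found = found
... | inj₂ none  = ⊥-elim (none j (n<1+n j) pj)

-- The schedule enumerates the pairs (i , r) with i ≤ r round by round,
-- (0,0) (0,1) (1,1) (0,2) (1,2) (2,2) …, and returns the entry i.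
advance : ℕ × ℕ → ℕ × ℕ
advance (i , r) with i <? r
... | yes _ = suc i , r
... | no _  = 0 , suc r

sweep : ℕ → ℕ × ℕ
sweep zero    = 0 , 0
sweep (suc j) = advance (sweep j)

schedule : ℕ → ℕ
schedule j = proj₁ (sweep j)

roundStart : ℕ → ℕ
roundStart zero    = 0
roundStart (suc r) = roundStart r + suc r

sweep-round : ∀ r i → i ≤ r → sweep (roundStart r + i) ≡ (i , r)
sweep-round zero    zero    _ = refl
sweep-round (suc r) zero    _
  rewrite +-identityʳ (roundStart r + suc r) | +-suc (roundStart r) r
        | sweep-round r r ≤-refl
  with r <? r
... | yes r<r = ⊥-elim (<-irrefl refl r<r)
... | no _    = refl
sweep-round r (suc i) i<r
  rewrite +-suc (roundStart r) i | sweep-round r i (<⇒≤ i<r)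
  with i <? r
... | yes _   = refl
... | no i≮r  = ⊥-elim (i≮r i<r)

roundStart-≥ : ∀ r → r ≤ roundStart r
roundStart-≥ zero    = z≤n
roundStart-≥ (suc r) = m≤n+m (suc r) (roundStart r)

-- Every value is scheduled at arbitrarily late times: in round b + k the
-- value b occurs at a time ≥ k.
schedule-recurrent : ∀ b k → Σ ℕ λ j → k ≤ j × schedule j ≡ b
schedule-recurrent b k =
  roundStart (b + k) + b ,
  ≤-trans (m≤n+m k b) (≤-trans (roundStart-≥ (b + k)) (m≤m+n (roundStart (b + k)) b)) ,
  cong proj₁ (sweep-round (b + k) b (m≤m+n b k))

lookup? : {A : Set} → List A → ℕ → Maybe A
lookup? []       _       = nothing
lookup? (x ∷ xs) zero    = just x
lookup? (x ∷ xs) (suc i) = lookup? xs i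

lookup?-++ : {A : Set} (xs ys : List A) {i : ℕ} {x : A} →
             lookup? xs i ≡ just x → lookup? (xs ++ ys) i ≡ just x
lookup?-++ (x ∷ xs) ys {zero}  found = found
lookup?-++ (x ∷ xs) ys {suc i} found = lookup?-++ xs ys found

∈⇒lookup? : {A : Set} {x : A} {xs : List A} → x ∈ xs → Σ ℕ λ i → lookup? xs i ≡ just x
∈⇒lookup? (here refl) = 0 , refl
∈⇒lookup? (there x∈xs) with ∈⇒lookup? x∈xs
... | i , found = suc i , found

data Position (n : ℕ) : ℕ → Set where
  before : ∀ {k} → k < n → Position n k
  after  : ∀ j → Position n (n + j)

position : ∀ n k → Position n k
position n k with k <? n
... | yes k<n = before k<n
... | no k≮n  = subst (Position n) (m+[n∸m]≡n (≮⇒≥ k≮n)) (after (k ∸ n))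

module NetFacts {H O : Set} (N : PetriNet H O) where
  open PetriNet N

  <ᴸ⇒≤ᴸ : ∀ {k} L → k <ᴸ L → k ≤ᴸ L
  <ᴸ⇒≤ᴸ (fin m) k<m = <⇒≤ k<m
  <ᴸ⇒≤ᴸ inf     _   = tt

  1+k≤ᴸ⇒k<ᴸ : ∀ {k} L → suc k ≤ᴸ L → k <ᴸ L
  1+k≤ᴸ⇒k<ᴸ (fin m) k<m = k<m
  1+k≤ᴸ⇒k<ᴸ inf     _   = tt

  <ᴸ-irrelevant : ∀ {k} L (p q : k <ᴸ L) → p ≡ q
  <ᴸ-irrelevant (fin m) p  q  = ≤-irrelevant p q
  <ᴸ-irrelevant inf     tt tt = refl

  _+ᴸ_ : ℕ → Len → Len
  n +ᴸ fin m = fin (n + m)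
  n +ᴸ inf   = inf

  n≤ᴸn+ᴸL : ∀ n L → n ≤ᴸ (n +ᴸ L)
  n≤ᴸn+ᴸL n (fin m) = m≤m+n n m
  n≤ᴸn+ᴸL n inf     = tt

  +ᴸ-cancel : ∀ n L {j} → (n + j) <ᴸ (n +ᴸ L) → j <ᴸ L
  +ᴸ-cancel n (fin m) {j} n+j<n+m = +-cancelˡ-< n j m n+j<n+m
  +ᴸ-cancel n inf     _          = tt

  +ᴸ-mono : ∀ n L {j} → j <ᴸ L → (n + j) <ᴸ (n +ᴸ L)
  +ᴸ-mono n (fin m) j<m = +-monoʳ-< n j<m
  +ᴸ-mono n inf     _   = tt

  step-cong : ∀ {M₁ M₂ u₁ u₂ M₁′ M₂′} → M₁ ≡ M₂ → u₁ ≡ u₂ → M₁′ ≡ M₂′ →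
              Step M₁ u₁ M₁′ → Step M₂ u₂ M₂′
  step-cong refl refl refl s = s

  fire-preserves-enabled : ∀ {M u M′ v} → Step M u M′ → Enabled M v →
                           (pre v ∩ₘ pre u) ≗ₘ ∅ₘ → Enabled M′ v
  fire-preserves-enabled {M} {u} {M′} {v} (_ , M′≗) en-v disjoint s
    rewrite M′≗ s with m⊓n≡0⇒m≡0∨n≡0 (pre v s) (pre u s) (disjoint s)
  ... | inj₁ v-s≡0 rewrite v-s≡0 = z≤n
  ... | inj₂ u-s≡0 rewrite u-s≡0 = ≤-trans (en-v s) (m≤m+n (M s) (post u s))

  contEnabled-later : ∀ π {v k} → ContEnabled π v k →
                      ∀ {j} → k ≤ j → j ≤ᴸ len π → Enabled (mark π j) v
  contEnabled-later π {v} {k} (_ , en-v , disjoint) k≤j = later (≤⇒≤′ k≤j)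
    where
    later : ∀ {j} → k ≤′ j → j ≤ᴸ len π → Enabled (mark π j) v
    later (≤′-reflexive refl) _ = en-v
    later (≤′-step {i} k≤′i) 1+i≤len =
      fire-preserves-enabled (steps π i p) (later k≤′i (<ᴸ⇒≤ᴸ (len π) p))
                             (disjoint i (≤′⇒≤ k≤′i) p)
      where p = 1+k≤ᴸ⇒k<ᴸ (len π) 1+i≤len

  path-reachable : ∀ π k → k ≤ᴸ len π → Reachable (mark π k)
  path-reachable π zero    _       = reach-init (init π)
  path-reachable π (suc k) 1+k≤len =
    reach-step (path-reachable π k (<ᴸ⇒≤ᴸ (len π) p)) (steps π k p)
    where p = 1+k≤ᴸ⇒k<ᴸ (len π) 1+k≤len

  enabled⇒marked : ∀ {M v s} → Enabled M v → pre v s ≢ 0 → M s ≢ 0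
  enabled⇒marked {v = v} {s} en-v consumes M-s≡0 =
    consumes (n≤0⇒n≡0 (subst (pre v s ≤_) M-s≡0 (en-v s)))

  preset-place : ExcludedMiddle 0ℓ → NonEmptyPresets → ∀ u → Σ S λ s → pre u s ≢ 0
  preset-place lem nonEmpty u with lem {Σ S λ s → pre u s ≢ 0}
  ... | yes found = found
  ... | no none   =
    ⊥-elim (nonEmpty u λ s → decidable-stable (pre u s ≟ 0) λ ≢0 → none (s , ≢0))

  EnablesNonBlocking : Marking → Set
  EnablesNonBlocking M = Σ T λ v → NonBlocking (ℓ v) × Enabled M v

  stuck-end⇒complete : ∀ π {m} → len π ≡ fin m →
                       ¬ EnablesNonBlocking (mark π m) → Complete π
  stuck-end⇒complete π {m} len≡m stuck a nb-a (v , k , cont@(k≤len , _ , _) , ℓv≡a) =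
    stuck (v , subst NonBlocking (sym ℓv≡a) nb-a ,
           contEnabled-later π cont (subst (k ≤ᴸ_) len≡m k≤len)
                                  (subst (m ≤ᴸ_) (sym len≡m) ≤-refl))

  Serves : Marking → T → S → Set
  Serves M u s = ∀ v → NonBlocking (ℓ v) → Enabled M v → pre v s ≢ 0 → pre u s ≢ 0

  FairFrom : ℕ → Path → Set
  FairFrom n π = ∀ k s → n ≤ k → mark π k s ≢ 0 →
                 Σ ℕ λ j → k ≤ j × Σ (j <ᴸ len π) λ p → Serves (mark π j) (trans π j p) s

  fair⇒complete : ExcludedMiddle 0ℓ → NonEmptyPresets → ∀ {n} π → len π ≡ inf →
                  FairFrom n π → Complete π
  fair⇒complete lem nonEmpty {n} π infinite fair a nb-a (v , k , cont@(_ , _ , disjoint) , ℓv≡a)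
    with preset-place lem nonEmpty v
  ... | s , v-consumes = refute (fair (n + k) s (m≤m+n n k) marked)
    where
    nb-v = subst NonBlocking (sym ℓv≡a) nb-a
    enabled-from-k : ∀ {i} → k ≤ i → Enabled (mark π i) v
    enabled-from-k k≤i = contEnabled-later π cont k≤i (subst (_ ≤ᴸ_) (sym infinite) tt)
    marked = enabled⇒marked (enabled-from-k (m≤n+m k n)) v-consumes
    -- the transition serving s later consumes from s, as v does
    refute : (Σ ℕ λ j → n + k ≤ j × Σ (j <ᴸ len π) λ p → Serves (mark π j) (trans π j p) s) → ⊥
    refute (j , n+k≤j , p , serves) =
      [ v-consumes , serves v nb-v (enabled-from-k k≤j) v-consumes ]′
        (m⊓n≡0⇒m≡0∨n≡0 _ _ (disjoint j k≤j p s))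
      where k≤j = ≤-trans (m≤n+m k n) n+k≤j

  record Run (M : Marking) : Set where
    field
      rlen   : Len
      rmark  : ℕ → Marking
      rtrans : (j : ℕ) → j <ᴸ rlen → T
      rinit  : rmark 0 ≡ M
      rsteps : (j : ℕ) (p : j <ᴸ rlen) → Step (rmark j) (rtrans j p) (rmark (suc j))

  open Run public

  FairRun : ∀ {M} → Run M → Set
  FairRun ρ = ∀ k s → rmark ρ k s ≢ 0 →
              Σ ℕ λ j → k ≤ j × Σ (j <ᴸ rlen ρ) λ p → Serves (rmark ρ j) (rtrans ρ j p) s

  module Append (π : Path) {n : ℕ} (π-fin : len π ≡ fin n) (ρ : Run (mark π n)) where

    inπ : ∀ {k} → k < n → k <ᴸ len π
    inπ {k} k<n = subst (k <ᴸ_) (sym π-fin) k<n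

    appMark : ℕ → Marking
    appMark k with k <? n
    ... | yes _ = mark π k
    ... | no _  = rmark ρ (k ∸ n)

    appTrans : (k : ℕ) → k <ᴸ (n +ᴸ rlen ρ) → T
    appTrans k p with k <? n
    ... | yes k<n = trans π k (inπ k<n)
    ... | no k≮n  = rtrans ρ (k ∸ n) (+ᴸ-cancel n (rlen ρ) p′)
      where p′ = subst (_<ᴸ (n +ᴸ rlen ρ)) (sym (m+[n∸m]≡n (≮⇒≥ k≮n))) p

    appMark-before : ∀ {k} → k ≤ n → appMark k ≡ mark π k
    appMark-before {k} k≤n with k <? n
    ... | yes _  = refl
    ... | no k≮n rewrite ≤-antisym k≤n (≮⇒≥ k≮n) | n∸n≡0 n = rinit ρ

    appMark-after : ∀ j → appMark (n + j) ≡ rmark ρ j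
    appMark-after j with n + j <? n
    ... | yes n+j<n = ⊥-elim (m+n≮m n j n+j<n)
    ... | no _      = cong (rmark ρ) (m+n∸m≡n n j)

    appTrans-before : ∀ k p q → appTrans k p ≡ trans π k q
    appTrans-before k p q with k <? n
    ... | yes k<n = cong (trans π k) (<ᴸ-irrelevant (len π) (inπ k<n) q)
    ... | no k≮n  = ⊥-elim (k≮n (subst (k <ᴸ_) π-fin q))

    rtrans-cong : ∀ {i j} → i ≡ j → ∀ p q → rtrans ρ i p ≡ rtrans ρ j q
    rtrans-cong {i} refl p q = cong (rtrans ρ i) (<ᴸ-irrelevant (rlen ρ) p q)

    appTrans-after : ∀ j p q → appTrans (n + j) p ≡ rtrans ρ j q
    appTrans-after j p q with n + j <? n
    ... | yes n+j<n = ⊥-elim (m+n≮m n j n+j<n)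
    ... | no _      = rtrans-cong (m+n∸m≡n n j) _ q

    appSteps : ∀ k p → Step (appMark k) (appTrans k p) (appMark (suc k))
    appSteps k p with position n k
    ... | before k<n =
      step-cong (sym (appMark-before (<⇒≤ k<n))) (sym (appTrans-before k p (inπ k<n)))
                (sym (appMark-before k<n)) (steps π k (inπ k<n))
    ... | after j =
      step-cong (sym (appMark-after j)) (sym (appTrans-after j p q))
                (sym (≡-trans (cong appMark (sym (+-suc n j))) (appMark-after (suc j))))
                (rsteps ρ j q)
      where q = +ᴸ-cancel n (rlen ρ) p

    appended : Path
    appended = record
      { len   = n +ᴸ rlen ρ
      ; mark  = appMark
      ; trans = appTrans
      ; init  = λ s → ≡-trans (cong (λ M → M s) (appMark-before z≤n)) (init π s)
      ; steps = appSteps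
      }

    appended-extends : Extends n π appended
    appended-extends =
      π-fin , n≤ᴸn+ᴸL n (rlen ρ) ,
      (λ k k≤n s → cong (λ M → M s) (appMark-before k≤n)) ,
      (λ k p p′ → appTrans-before k p′ p)

    appended-nonBlocking : (∀ j p → NonBlocking (ℓ (rtrans ρ j p))) →
                           NonBlockingFrom n appended
    appended-nonBlocking nb k n≤k p with position n k
    ... | before k<n = ⊥-elim (<⇒≱ k<n n≤k)
    ... | after j    =
      subst (λ u → NonBlocking (ℓ u)) (sym (appTrans-after j p q)) (nb j q)
      where q = +ᴸ-cancel n (rlen ρ) p

    appended-fair : FairRun ρ → FairFrom n appended
    appended-fair fair k s n≤k marked with position n k
    ... | before k<n = ⊥-elim (<⇒≱ k<n n≤k)
    ... | after i    = shift (fair i s (subst (λ M → M s ≢ 0) (appMark-after i) marked))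
      where
      shift : (Σ ℕ λ j → i ≤ j × Σ (j <ᴸ rlen ρ) λ p → Serves (rmark ρ j) (rtrans ρ j p) s) →
              Σ ℕ λ j → n + i ≤ j × Σ (j <ᴸ (n +ᴸ rlen ρ)) λ p → Serves (appMark j) (appTrans j p) s
      shift (j , i≤j , p , serves) =
        n + j , +-monoʳ-≤ n i≤j , p′ ,
        subst₂ (λ M u → Serves M u s) (sym (appMark-after j)) (sym (appTrans-after j p′ p)) serves
        where p′ = +ᴸ-mono n (rlen ρ) p

module FairScheduler (lem : ExcludedMiddle 0ℓ) {H O : Set} (N : PetriNet H O)
                     (finite : PetriNet.FiniteReachable N)
                     (M₁ : PetriNet.Marking N) (M₁-reachable : PetriNet.Reachable N M₁) where
  open PetriNet N
  open NetFacts N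

  record State : Set where
    field
      marking   : Marking
      reachable : Reachable marking
      places    : List S
      covers    : ∀ s → marking s ≢ 0 → s ∈ places

  open State

  fire : (st : State) (u : T) → Enabled (marking st) u → State
  fire st u en = record
    { marking   = M′
    ; reachable = M′-reachable
    ; places    = places st ++ proj₁ (finite M′ M′-reachable)
    ; covers    = λ s marked → ∈-++⁺ʳ (places st) (proj₂ (finite M′ M′-reachable) s marked)
    }
    where
    M′ = (marking st -ₘ pre u) +ₘ post u
    M′-reachable = reach-step (reachable st) (en , λ _ → refl)

  record Move (M : Marking) (target : Maybe S) : Set where
    field
      transition  : T
      nonBlocking : NonBlocking (ℓ transition)
      enabled     : Enabled M transition
      serves      : ∀ s → target ≡ just s → Serves M transition s

  open Move

  aim : ∀ {M} (target : Maybe S) → EnablesNonBlocking M → Move M target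
  aim nothing (v , nb-v , en-v) = record
    { transition = v ; nonBlocking = nb-v ; enabled = en-v ; serves = λ _ () }
  aim {M} (just s) (v , nb-v , en-v)
    with lem {Σ T λ u → NonBlocking (ℓ u) × Enabled M u × pre u s ≢ 0}
  ... | yes (u , nb-u , en-u , consumes) = record
    { transition = u ; nonBlocking = nb-u ; enabled = en-u
    ; serves = λ { _ refl _ _ _ _ → consumes } }
  ... | no none = record
    { transition = v ; nonBlocking = nb-v ; enabled = en-v
    ; serves = λ { _ refl w nb-w en-w consumes → ⊥-elim (none (w , nb-w , en-w , consumes)) } }

  Decision : Marking → Maybe S → Set
  Decision M target = ¬ EnablesNonBlocking M ⊎ Move M target

  choose : (M : Marking) (target : Maybe S) → Decision M target
  choose M target with lem {EnablesNonBlocking M}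
  ... | yes candidate = inj₂ (aim target candidate)
  ... | no stuck      = inj₁ stuck

  successor : (st : State) {target : Maybe S} → Decision (marking st) target → State
  successor st (inj₁ _)  = st
  successor st (inj₂ mv) = fire st (transition mv) (enabled mv)

  theMove : ∀ {M target} → Decision M target → ¬ ¬ EnablesNonBlocking M → Move M target
  theMove (inj₁ stuck) live = ⊥-elim (live stuck)
  theMove (inj₂ mv)    _    = mv

  successor-step : ∀ st {target} (d : Decision (marking st) target)
                   (live : ¬ ¬ EnablesNonBlocking (marking st)) →
                   Step (marking st) (transition (theMove d live)) (marking (successor st d))
  successor-step st (inj₁ stuck) live = ⊥-elim (live stuck)
  successor-step st (inj₂ mv)    _    = enabled mv , λ _ → refl

  successor-keeps : ∀ st {target} (d : Decision (marking st) target) {b s} → lookup? (places st) b ≡ just s → lookup? (places (successor st d)) b ≡ just s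
  successor-keeps st (inj₁ _) found = found
  successor-keeps st (inj₂ _) found = lookup?-++ (places st) _ found

  start : State
  start = record
    { marking = M₁ ; reachable = M₁-reachable
    ; places = proj₁ (finite M₁ M₁-reachable) ; covers = proj₂ (finite M₁ M₁-reachable) }

  targetPlace : State → ℕ → Maybe S
  targetPlace st j = lookup? (places st) (schedule j)

  decide : (st : State) (j : ℕ) → Decision (marking st) (targetPlace st j)
  decide st j = choose (marking st) (targetPlace st j)

  states : ℕ → State
  states zero    = start
  states (suc j) = successor (states j) (decide (states j) j)

  Stuck : ℕ → Set
  Stuck j = ¬ EnablesNonBlocking (marking (states j))

  places-persist : ∀ {i j b s} → i ≤ j →
                   lookup? (places (states i)) b ≡ just s → lookup? (places (states j)) b ≡ just s
  places-persist i≤j = go (≤⇒≤′ i≤j)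
    where
    go : ∀ {i j b s} → i ≤′ j →
         lookup? (places (states i)) b ≡ just s → lookup? (places (states j)) b ≡ just s
    go (≤′-reflexive refl) found = found
    go (≤′-step {j} i≤′j) found  = successor-keeps (states j) (decide (states j) j) (go i≤′j found)

  run : (L : Len) → (∀ j → j <ᴸ L → ¬ Stuck j) → Run M₁
  run L live = record
    { rlen   = L
    ; rmark  = λ j → marking (states j)
    ; rtrans = λ j p → transition (theMove (decide (states j) j) (live j p))
    ; rinit  = refl
    ; rsteps = λ j p → successor-step (states j) (decide (states j) j) (live j p)
    }

  run-nonBlocking : ∀ L live j p → NonBlocking (ℓ (rtrans (run L live) j p))
  run-nonBlocking L live j p = nonBlocking (theMove (decide (states j) j) (live j p))

  -- A scheduler that is never stuck runs fairly: a marked place is listed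
  -- at some index b, and b is targeted again later.
  run-fair : (never : ∀ j → ¬ Stuck j) → FairRun (run inf λ j _ → never j)
  run-fair never k s marked with ∈⇒lookup? (covers (states k) s marked)
  ... | b , listed with schedule-recurrent b k
  ...   | j , k≤j , scheduled-b =
    j , k≤j , tt ,
    serves (theMove (decide (states j) j) (never j)) s
      (subst (λ i → lookup? (places (states j)) i ≡ just s) (sym scheduled-b)
             (places-persist k≤j listed))

lemma4 : ExcludedMiddle 0ℓ → {H O : Set} (N : PetriNet H O) →
    PetriNet.IsNet N →
    (n : ℕ) (π : PetriNet.Path N) → PetriNet.len π ≡ PetriNet.fin n →
    Σ (PetriNet.Path N) λ π' →
    PetriNet.Extends N n π π' × PetriNet.Complete N π' ×
    PetriNet.NonBlockingFrom N n π'
lemma4 lem N (_ , nonEmpty , finite) n π π-fin = extension (lem {Σ ℕ Stuck})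
  where
  open PetriNet N
  open NetFacts N
  open Append π π-fin
  open FairScheduler lem N finite (mark π n)
                     (path-reachable π n (subst (n ≤ᴸ_) (sym π-fin) ≤-refl))

  extension : Dec (Σ ℕ Stuck) →
              Σ Path λ π′ → Extends n π π′ × Complete π′ × NonBlockingFrom n π′
  -- the scheduler gets stuck: stop at the first time m it is
  extension (yes (j , stuck-j)) with least {Stuck} (λ _ → lem) {j} stuck-j
  ... | m , stuck-m , live =
    appended ρ , appended-extends ρ ,
    stuck-end⇒complete (appended ρ) refl
      (subst (λ M → ¬ EnablesNonBlocking M) (sym (appMark-after ρ m)) stuck-m) ,
    appended-nonBlocking ρ (run-nonBlocking _ live)
    where ρ = run (fin m) live
  extension (no never) =
    appended ρ , appended-extends ρ ,
    fair⇒complete lem nonEmpty (appended ρ) refl (appended-fair ρ (run-fair never-stuck)) ,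
    appended-nonBlocking ρ (run-nonBlocking _ _)
    where
    never-stuck : ∀ j → ¬ Stuck j
    never-stuck j stuck = never (j , stuck)
    ρ = run inf λ j _ → never-stuck j
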